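{- For all names $R,Q$: if $\eta\,R\,(klass\,(\mathit{InteriorPoint}\,Q))$, then $\eta\,R\,\mathit{Region}$.
   Context: Setting: a Coq formalization (classical logic) of Leśniewski's Ontology and Mereology extended with Tarski's geometry of solids. Names form a type $N$ with a primitive relation $\eta:N\to N\to\mathrm{Prop}$ satisfying Leśniewski's ontological axiom $\eta\,A\,b \leftrightarrow ((\exists C,\eta\,C\,A)\wedge(\forall C\,D,\eta\,C\,A\wedge\eta\,D\,A\to\eta\,C\,D)\wedge(\forall C,\eta\,C\,A\to\eta\,C\,b))$; $A$ is an individual iff $\eta\,A\,A$; $a\subseteq b$ means $\forall P,\eta\,P\,a\to\eta\,P\,b$. Mereology: $pt:N\to N$ ($\eta\,B\,(pt\,A)$: $B$ is a part of $A$) satisfying Leśniewski's mereology axioms (part-of a partial order on individuals; every non-empty name has a unique m-class). M-class: $\eta\,A\,(klass\,a)$ iff $\eta\,A\,A$, $\forall B,\eta\,B\,a\to\eta\,B\,(pt\,A)$, and $\forall B,\eta\,B\,(pt\,A)\to\exists C\,D,\eta\,C\,a\wedge\eta\,D\,(pt\,C)\wedge\eta\,D\,(pt\,B)$. $X$ is exterior to $Y$ iff they have no common part. Geometry: $\mathit{balls}$ is a primitive name (there exists at least one ball). Tarski's definitions for balls: $A$ is externally tangent to $B$ iff $A$ is exterior to $B$ and for any balls $X,Y$ both having $A$ as part and both exterior to $B$, one of $X,Y$ is part of the other; $A$ is internally tangent to $B$ iff $A$ is a proper part of $B$ and for any balls $X,Y$ both having $A$ as a part and both parts of $B$, one of $X,Y$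 is part of the other; $A,B$ are externally diametrical w.r.t. $C$ iff both are externally tangent to $C$ and for any balls $X,Y$ exterior to $C$ with $A$ part of $X$ and $B$ part of $Y$, $X$ is exterior to $Y$; $A,B$ are internally diametrical w.r.t. $C$ iff both are internally tangent to $C$ and for any balls $X,Y$ externally tangent to $C$ with $A$ exterior to $X$ and $B$ exterior to $Y$, $X$ is exterior to $Y$; $A$ is concentric with $B$ iff $A=B$, or $A$ is a proper part of $B$ and any balls $X,Y$ externally diametrical w.r.t. $A$ and internally tangent to $B$ are internally diametrical w.r.t. $B$, or the same holds with $A,B$ interchanged. $\eta\,P\,(\mathit{Concent}\,Q)$ iff $P,Q$ are balls and $P$ is concentric with $Q$. Point: $\eta\,P\,(\mathit{Point}\,Q)$ iff $\eta\,P\,\mathit{balls}\wedge\eta\,Q\,\mathit{balls}\wedge\eta\,P\,(\mathit{Concent}\,Q)$. Region: $\eta\,P\,\mathit{Region}$ iff $\eta\,P\,P$ and $\exists b,\ b\subseteq\mathit{balls}\wedge\eta\,P\,(klass\,b)$. Interior point: $\eta\,P\,(\mathit{InteriorPoint}\,Q)$ iff $\eta\,Q\,\mathit{Region}$ and $\exists P',\ \eta\,P\,(\mathit{Point}\,P')\wedge\eta\,P'\,(pt\,Q)$. -}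

module Defs where

open import Data.Product using (Σ; ∃; _×_; _,_)
open import Data.Sum using (_⊎_)
open import Relation.Nullary using (¬_)
open import Function.Bundles using (_⇔_)

-- Primitive vocabulary of Ontology + Mereology + Tarski's geometry of solids.
record Signature : Set₁ where
  field
    N     : Set
    η     : N → N → Set
    pt    : N → N
    klass : N → N
    balls : N

module Notions (S : Signature) where
  open Signature S

  individual : N → Set
  individual A = η A A

  _⊆_ : N → N → Set
  a ⊆ b = ∀ P → η P a → η P b

  -- A is part of B (pt is the (improper) part-of relation)
  partOf : N → N → Set
  partOf A B = η A (pt B)

  properPart : N → N → Set
  properPart A B = η A (pt B) × ¬ (A ≡N B)
    where
    _≡N_ : N → N → Set
    X ≡N Y = η X Y × η Y X

  exterior : N → N → Set
  exterior X Y = η X X × η Y Y × ¬ (∃ λ Z → η Z (pt X) × η Z (pt Y))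

  isBall : N → Set
  isBall X = η X balls

  ExtTangent : N → N → Set
  ExtTangent A B = isBall A × isBall B × exterior A B ×
    (∀ X Y → isBall X → isBall Y →
       η A (pt X) → η A (pt Y) → exterior X B → exterior Y B →
       η X (pt Y) ⊎ η Y (pt X))

  IntTangent : N → N → Set
  IntTangent A B = isBall A × isBall B × properPart A B ×
    (∀ X Y → isBall X → isBall Y →
       η A (pt X) → η A (pt Y) → η X (pt B) → η Y (pt B) →
       η X (pt Y) ⊎ η Y (pt X))

  ExtDiam : N → N → N → Set
  ExtDiam A B C = ExtTangent A C × ExtTangent B C ×
    (∀ X Y → isBall X → isBall Y → exterior X C → exterior Y C →
       η A (pt X) → η B (pt Y) → exterior X Y)

  IntDiam : N → N → N → Set
  IntDiam A B C = IntTangent A C × IntTangent B C ×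
    (∀ X Y → isBall X → isBall Y → ExtTangent X C → ExtTangent Y C →
       exterior A X → exterior B Y → exterior X Y)

  concentricStrict : N → N → Set
  concentricStrict A B = properPart A B ×
    (∀ X Y → isBall X → isBall Y → ExtDiam X Y A → IntTangent X B → IntTangent Y B →
       IntDiam X Y B)

  Concentric : N → N → Set
  Concentric A B = (isBall A × isBall B × η A B × η B A)
                   ⊎ concentricStrict A B ⊎ concentricStrict B A

  InKlass : N → N → Set
  InKlass A a = η A A × (∀ B → η B a → η B (pt A)) ×
    (∀ B → η B (pt A) → ∃ λ C → ∃ λ D → η C a × η D (pt C) × η D (pt B))

record Theory (S : Signature) : Set₁ where
  open Signature S
  open Notions S
  field
    classical : ∀ (P : Set) → P ⊎ ¬ P
    ontology  : ∀ A b → η A b ⇔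
      ((∃ λ C → η C A) × (∀ C D → η C A → η D A → η C D) × (∀ C → η C A → η C b))
    pt-ind    : ∀ A B → η A (pt B) → η A A × η B B
    pt-refl   : ∀ A → η A A → η A (pt A)
    pt-antisym : ∀ A B → η A (pt B) → η B (pt A) → η A B
    pt-trans  : ∀ A B C → η A (pt B) → η B (pt C) → η A (pt C)
    klass-def : ∀ A a → η A (klass a) ⇔ InKlass A a
    klass-exists : ∀ a → (∃ λ A → η A a) → ∃ λ C → η C (klass a)
    klass-unique : ∀ a C D → η C (klass a) → η D (klass a) → η C D
    ball-exists : ∃ λ B → η B balls
    Concent : N → N
    Concent-def : ∀ P Q → η P (Concent Q) ⇔ (η P balls × η Q balls × Concentric P Q)
    Point : N → N
    Point-def : ∀ P Q → η P (Point Q) ⇔ (η P balls × η Q balls × η P (Concent Q))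
    Region : N
    Region-def : ∀ P → η P Region ⇔ (η P P × ∃ λ b → (b ⊆ balls) × η P (klass b))
    InteriorPoint : N → N
    InteriorPoint-def : ∀ P Q → η P (InteriorPoint Q) ⇔
      (η Q Region × ∃ λ P′ → η P (Point P′) × η P′ (pt Q))

module Submission where

open import Defs
open import Data.Product using (_,_; proj₁)
open import Function.Bundles using (Equivalence)

module _ (S : Signature) (T : Theory S) where
  open Signature S
  open Notions S using (_⊆_)
  open Theory T

  Point⊆balls : ∀ Q → Point Q ⊆ balls
  Point⊆balls Q P p = proj₁ (Equivalence.to (Point-def P Q) p)

  InteriorPoint⊆balls : ∀ Q → InteriorPoint Q ⊆ balls
  InteriorPoint⊆balls Q P p with Equivalence.to (InteriorPoint-def P Q) p
  ... | _ , Q′ , p∈PointQ′ , _ = Point⊆balls Q′ P p∈PointQ′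

  klass-of-balls-is-Region : ∀ b → b ⊆ balls → ∀ R → η R (klass b) → η R Region
  klass-of-balls-is-Region b b⊆balls R R∈klass =
    Equivalence.from (Region-def R)
      (proj₁ (Equivalence.to (klass-def R b) R∈klass) , b , b⊆balls , R∈klass)

theorem4 : (S : Signature) → (T : Theory S) →
    ∀ R Q → Signature.η S R (Signature.klass S (Theory.InteriorPoint T Q)) →
    Signature.η S R (Theory.Region T)
theorem4 S T R Q =
  klass-of-balls-is-Region S T (Theory.InteriorPoint T Q) (InteriorPoint⊆balls S T Q) R
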